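{- Let $k$ be a field. (i) If $\operatorname{char}k$ is $0$ or greater than $3$, then $u(3,k)\neq 2$. (ii) For all positive integers $d,n$ (with $\operatorname{char}k$ equal to $0$ or greater than $d^n$), $u(d^n,k)\geq u(d,k)^n$. (iii) If $u(d_1,k)=u$, then $u(md_1,k)\geq u$ for every integer $m>1$ (with $\operatorname{char}k$ equal to $0$ or greater than $md_1$).
   Context: A form of degree $e$ and dimension $n$ over $k$ is a homogeneous polynomial of degree $e$ in $n$ variables over $k$; it is anisotropic if it has no nontrivial zero in $k^n$. $u(e,k)$ is the supremum of the dimensions of anisotropic forms of degree $e$ over $k$. The paper's standing convention is that forms of degree $e$ are considered over fields of characteristic $0$ or greater than $e$. -}

module Defs where

open import Level using (Level; _⊔_; suc)
open import Algebra.Bundles using (CommutativeRing)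
open import Data.Nat as ℕ using (ℕ; zero; suc)
open import Data.Fin using (Fin)
open import Data.List using (List; []; _∷_; foldr; map; allFin)
open import Data.List.Relation.Unary.All using (All)
open import Data.Product using (Σ; ∃; _×_; _,_)
open import Relation.Binary.PropositionalEquality using (_≡_)
open import Relation.Nullary using (¬_)

record Field (c ℓ : Level) : Set (Level.suc (c ⊔ ℓ)) where
  field
    commutativeRing : CommutativeRing c ℓ
  open CommutativeRing commutativeRing public
  field
    1≉0     : ¬ (1# ≈ 0#)
    inverse : ∀ x → ¬ (x ≈ 0#) → ∃ λ y → x * y ≈ 1#

module _ {c ℓ : Level} (k : Field c ℓ) where
  open Field k

  pow : Carrier → ℕ → Carrier
  pow x zero    = 1#
  pow x (suc n) = x * pow x n

  natToK : ℕ → Carrier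
  natToK zero    = 0#
  natToK (suc j) = 1# + natToK j

  -- char k = 0 or char k > e   (i.e. j · 1 ≠ 0 for 1 ≤ j ≤ e)
  CharZeroOrAbove : ℕ → Set ℓ
  CharZeroOrAbove e = ∀ j → 1 ℕ.≤ j → j ℕ.≤ e → ¬ (natToK j ≈ 0#)

  degree : ∀ {n} → (Fin n → ℕ) → ℕ
  degree {n} a = foldr ℕ._+_ 0 (map a (allFin n))

  monomial : ∀ {n} → (Fin n → ℕ) → (Fin n → Carrier) → Carrier
  monomial {n} a x = foldr _*_ 1# (map (λ i → pow (x i) (a i)) (allFin n))

  record Form (e n : ℕ) : Set c where
    constructor form
    field
      terms       : List (Carrier × (Fin n → ℕ))
      homogeneous : All (λ t → degree (Data.Product.proj₂ t) ≡ e) terms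

  eval : ∀ {e n} → Form e n → (Fin n → Carrier) → Carrier
  eval f x = foldr (λ t s → (Data.Product.proj₁ t * monomial (Data.Product.proj₂ t) x) + s)
                   0# (Form.terms f)

  Anisotropic : ∀ {e n} → Form e n → Set (c ⊔ ℓ)
  Anisotropic {n = n} f =
    ¬ (Σ (Fin n → Carrier) λ x → (Σ (Fin n) λ i → ¬ (x i ≈ 0#)) × (eval f x ≈ 0#))

  HasAnisotropicForm : ℕ → ℕ → Set (c ⊔ ℓ)
  HasAnisotropicForm e n = Σ (Form e n) Anisotropic

data ℕ∞ : Set where
  fin : ℕ → ℕ∞
  ∞   : ℕ∞

data _≤∞_ : ℕ∞ → ℕ∞ → Set where
  fin≤fin : ∀ {m n} → m ℕ.≤ n → fin m ≤∞ fin n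
  _≤∞∞    : ∀ x → x ≤∞ ∞

_^∞_ : ℕ∞ → ℕ → ℕ∞
fin m ^∞ n     = fin (m ℕ.^ n)
∞ ^∞ zero      = fin 1
∞ ^∞ suc n     = ∞

-- IsU k e x : x is u(e,k), the supremum (in ℕ ∪ {∞}) of the dimensions
-- of anisotropic forms of degree e over k.
IsU : ∀ {c ℓ} → Field c ℓ → ℕ → ℕ∞ → Set (c ⊔ ℓ)
IsU k e x =
  (∀ n → HasAnisotropicForm k e n → fin n ≤∞ x) ×
  (∀ z → (∀ n → HasAnisotropicForm k e n → fin n ≤∞ z) → x ≤∞ z)

module Submission where

-- All three parts come from constructions turning anisotropic forms into
-- anisotropic forms; none of them needs the hypotheses on the characteristic.
--   (iii) If f is anisotropic of degree d, so is fᵐ (of degree m·d).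
--   (ii)  If f is anisotropic of degree d in r variables, the n-fold composite
--         f(f(…),…,f(…)) in rⁿ variables is anisotropic of degree dⁿ.
--   (i)   If G(X,Y) = aX³ + bX²Y + cXY² + dY³ is anisotropic, an explicit ternary
--         cubic N with coefficients polynomial in a, b, c, d is anisotropic; this is
--         shown by an elimination argument resting on polynomial identities,
--         checked by the ring solver with integer coefficients.  Finally, general facts about u turn the
-- constructions into the inequalities: u is monotone along constructions that
-- preserve the dimension, raised to the n-th power along r ↦ rⁿ, and a finite
-- value of u is (up to double negation) attained, so u(3,k) = 2 would give an
-- anisotropic ternary cubic.

open import Defs
open import Level using (Level; _⊔_)
open import Algebra.Bundles using (CommutativeRing)
open import Data.Nat as ℕ using (ℕ; zero; suc)
import Data.Nat.Properties as ℕ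
open import Data.Integer as ℤ using (ℤ; -[1+_]; _⊖_)
open import Data.Integer.Properties using ([1+m]⊖[1+n]≡m⊖n)
open import Data.Sign as Sign using (Sign)
open import Data.Fin using (Fin; zero; suc; combine)
open import Data.Fin.Properties using (combine-surjective)
open import Data.List using (List; []; _∷_; foldr; map; allFin; _++_)
open import Data.List.Properties using (map-tabulate)
open import Data.List.Relation.Unary.All using (All; []; _∷_)
open import Data.Maybe using (Maybe; just; nothing)
open import Data.Product using (Σ; _,_; proj₁; proj₂)
open import Data.Sum using (_⊎_; inj₁; inj₂; map₁)
open import Data.Empty using (⊥; ⊥-elim)
open import Data.Bool using (if_then_else_)
open import Function using (_∘_; id)
open import Relation.Binary.PropositionalEquality as P using (_≡_)
open import Relation.Nullary using (¬_; yes; no)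
import Algebra.Solver.Ring.AlmostCommutativeRing as ACR

-- Integers map homomorphically into R and their equality is decidable, so the
-- solver can verify identities that rely on cancellation of coefficients.
module IntegerCoefficients {c ℓ : Level} (R : CommutativeRing c ℓ) where
  open CommutativeRing R
  open import Relation.Binary.Reasoning.Setoid setoid
  open import Algebra.Properties.Semiring.Mult.TCOptimised semiring using (_×_; ×-homo-+; ×1-homo-*; 1+×)
  open import Algebra.Properties.Ring ring using (-‿involutive; -1*x≈-x)
  open import Algebra.Properties.AbelianGroup +-abelianGroup using (⁻¹-∙-comm; ε⁻¹≈ε)
  open import Algebra.Properties.CommutativeSemigroup +-commutativeSemigroup
    using () renaming (interchange to +-interchange)
  open import Algebra.Properties.CommutativeSemigroup *-commutativeSemigroup
    using () renaming (interchange to *-interchange)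

  ⟦_⟧ℤ : ℤ → Carrier
  ⟦ ℤ.+ n ⟧ℤ    = n × 1#
  ⟦ -[1+ n ] ⟧ℤ = - (suc n × 1#)

  shift-difference : ∀ a b → a - b ≈ (1# + a) - (1# + b)
  shift-difference a b = begin
    a - b                       ≈⟨ +-identityˡ (a - b) ⟨
    0# + (a - b)                ≈⟨ +-congʳ (-‿inverseʳ 1#) ⟨
    (1# - 1#) + (a - b)         ≈⟨ +-interchange 1# (- 1#) a (- b) ⟩
    (1# + a) + (- 1# - b)       ≈⟨ +-congˡ (⁻¹-∙-comm 1# b) ⟩
    (1# + a) - (1# + b)         ∎

  ⊖-homo : ∀ m n → ⟦ m ⊖ n ⟧ℤ ≈ m × 1# - n × 1#
  ⊖-homo m       zero    = sym (trans (+-congˡ ε⁻¹≈ε) (+-identityʳ _))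
  ⊖-homo zero    (suc n) = sym (+-identityˡ _)
  ⊖-homo (suc m) (suc n) = begin
    ⟦ suc m ⊖ suc n ⟧ℤ                ≡⟨ P.cong ⟦_⟧ℤ ([1+m]⊖[1+n]≡m⊖n m n) ⟩
    ⟦ m ⊖ n ⟧ℤ                        ≈⟨ ⊖-homo m n ⟩
    m × 1# - n × 1#                   ≈⟨ shift-difference _ _ ⟩
    (1# + m × 1#) - (1# + n × 1#)     ≈⟨ +-cong (1+× m 1#) (-‿cong (1+× n 1#)) ⟨
    suc m × 1# - suc n × 1#           ∎

  +-homo : ∀ i j → ⟦ i ℤ.+ j ⟧ℤ ≈ ⟦ i ⟧ℤ + ⟦ j ⟧ℤ
  +-homo (ℤ.+ m)  (ℤ.+ n)  = ×-homo-+ 1# m n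
  +-homo (ℤ.+ m)  -[1+ n ] = ⊖-homo m (suc n)
  +-homo -[1+ m ] (ℤ.+ n)  = trans (⊖-homo n (suc m)) (+-comm _ _)
  +-homo -[1+ m ] -[1+ n ] = begin
    - (suc (suc (m ℕ.+ n)) × 1#)      ≡⟨ P.cong (λ k → - (suc k × 1#)) (ℕ.+-suc m n) ⟨
    - ((suc m ℕ.+ suc n) × 1#)        ≈⟨ -‿cong (×-homo-+ 1# (suc m) (suc n)) ⟩
    - (suc m × 1# + suc n × 1#)       ≈⟨ ⁻¹-∙-comm _ _ ⟨
    - (suc m × 1#) - (suc n × 1#)     ∎

  -- Multiplication of integers goes through signs and absolute values:
  -- ⟦ s ◃ n ⟧ℤ ≈ ⟦ s ⟧± * n × 1#, with ⟦ s ⟧± = ±1.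
  ⟦_⟧± : Sign → Carrier
  ⟦ Sign.+ ⟧± = 1#
  ⟦ Sign.- ⟧± = - 1#

  ◃-homo : ∀ s n → ⟦ s ℤ.◃ n ⟧ℤ ≈ ⟦ s ⟧± * (n × 1#)
  ◃-homo s      zero    = sym (zeroʳ _)
  ◃-homo Sign.+ (suc n) = sym (*-identityˡ _)
  ◃-homo Sign.- (suc n) = sym (-1*x≈-x _)

  sign-homo : ∀ s t → ⟦ s Sign.* t ⟧± ≈ ⟦ s ⟧± * ⟦ t ⟧±
  sign-homo Sign.+ t      = sym (*-identityˡ _)
  sign-homo Sign.- Sign.+ = sym (*-identityʳ _)
  sign-homo Sign.- Sign.- = sym (trans (-1*x≈-x _) (-‿involutive _))

  sign-abs : ∀ i → ⟦ i ⟧ℤ ≈ ⟦ ℤ.sign i ⟧± * (ℤ.∣ i ∣ × 1#)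
  sign-abs (ℤ.+ n)  = sym (*-identityˡ _)
  sign-abs -[1+ n ] = sym (-1*x≈-x _)

  *-homo : ∀ i j → ⟦ i ℤ.* j ⟧ℤ ≈ ⟦ i ⟧ℤ * ⟦ j ⟧ℤ
  *-homo i j = begin
    ⟦ i ℤ.* j ⟧ℤ
      ≈⟨ ◃-homo (ℤ.sign i Sign.* ℤ.sign j) (ℤ.∣ i ∣ ℕ.* ℤ.∣ j ∣) ⟩
    ⟦ ℤ.sign i Sign.* ℤ.sign j ⟧± * ((ℤ.∣ i ∣ ℕ.* ℤ.∣ j ∣) × 1#)
      ≈⟨ *-cong (sign-homo (ℤ.sign i) (ℤ.sign j)) (×1-homo-* ℤ.∣ i ∣ ℤ.∣ j ∣) ⟩
    (⟦ ℤ.sign i ⟧± * ⟦ ℤ.sign j ⟧±) * (ℤ.∣ i ∣ × 1# * ℤ.∣ j ∣ × 1#)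
      ≈⟨ *-interchange _ _ _ _ ⟩
    (⟦ ℤ.sign i ⟧± * ℤ.∣ i ∣ × 1#) * (⟦ ℤ.sign j ⟧± * ℤ.∣ j ∣ × 1#)
      ≈⟨ *-cong (sign-abs i) (sign-abs j) ⟨
    ⟦ i ⟧ℤ * ⟦ j ⟧ℤ ∎

  neg-homo : ∀ i → ⟦ ℤ.- i ⟧ℤ ≈ - ⟦ i ⟧ℤ
  neg-homo (ℤ.+ zero)  = sym ε⁻¹≈ε
  neg-homo (ℤ.+ suc n) = refl
  neg-homo -[1+ n ]   = sym (-‿involutive _)

  homomorphism : ℤ.+-*-rawRing ACR.-Raw-AlmostCommutative⟶ ACR.fromCommutativeRing R
  homomorphism = record
    { ⟦_⟧ = ⟦_⟧ℤ ; +-homo = +-homo ; *-homo = *-homo ; -‿homo = neg-homo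
    ; 0-homo = refl ; 1-homo = refl }

  ≟-coefficients : ∀ i j → Maybe (⟦ i ⟧ℤ ≈ ⟦ j ⟧ℤ)
  ≟-coefficients i j with i ℤ.≟ j
  ... | yes P.refl = just refl
  ... | no _       = nothing

  open import Algebra.Solver.Ring ℤ.+-*-rawRing (ACR.fromCommutativeRing R) homomorphism ≟-coefficients public

foldr-allFin-suc : ∀ {a} {A : Set a} {n} (_∙_ : A → A → A) (ε : A) (g : Fin (suc n) → A) →
  foldr _∙_ ε (map g (allFin (suc n))) ≡ g zero ∙ foldr _∙_ ε (map (g ∘ suc) (allFin n))
foldr-allFin-suc {n = n} _∙_ ε g = P.cong (λ l → g zero ∙ foldr _∙_ ε l)
  (P.trans (map-tabulate suc g) (P.sym (map-tabulate id (g ∘ suc))))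

-- Exponent vectors: the zero vector, the unit vectors and the sum of two vectors,
-- and their total degree (definitionally the 'degree' of Defs).
𝟘 : ∀ {n} → Fin n → ℕ
𝟘 _ = 0

unit : ∀ {n} → Fin n → Fin n → ℕ
unit zero    zero    = 1
unit zero    (suc j) = 0
unit (suc i) zero    = 0
unit (suc i) (suc j) = unit i j

_⊹_ : ∀ {n} → (Fin n → ℕ) → (Fin n → ℕ) → Fin n → ℕ
(u ⊹ v) i = u i ℕ.+ v i

total : ∀ {n} → (Fin n → ℕ) → ℕ
total {n} u = foldr ℕ._+_ 0 (map u (allFin n))

total-𝟘 : ∀ n → total (𝟘 {n}) ≡ 0
total-𝟘 zero    = P.refl
total-𝟘 (suc n) = P.trans (foldr-allFin-suc ℕ._+_ 0 (𝟘 {suc n})) (total-𝟘 n)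

total-unit : ∀ {n} (i : Fin n) → total (unit i) ≡ 1
total-unit {suc n} zero    = P.trans (foldr-allFin-suc ℕ._+_ 0 (unit {suc n} zero)) (P.cong suc (total-𝟘 n))
total-unit {suc n} (suc i) = P.trans (foldr-allFin-suc ℕ._+_ 0 (unit {suc n} (suc i))) (total-unit i)

total-⊹ : ∀ {n} (u v : Fin n → ℕ) → total (u ⊹ v) ≡ total u ℕ.+ total v
total-⊹ {zero}  u v = P.refl
total-⊹ {suc n} u v = begin
  total (u ⊹ v)                                         ≡⟨ foldr-allFin-suc ℕ._+_ 0 (u ⊹ v) ⟩
  (u zero ℕ.+ v zero) ℕ.+ total ((u ⊹ v) ∘ suc)         ≡⟨ P.cong (u zero ℕ.+ v zero ℕ.+_) (total-⊹ (u ∘ suc) (v ∘ suc)) ⟩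
  (u zero ℕ.+ v zero) ℕ.+ (total (u ∘ suc) ℕ.+ total (v ∘ suc)) ≡⟨ ℕ-interchange (u zero) (v zero) _ _ ⟩
  (u zero ℕ.+ total (u ∘ suc)) ℕ.+ (v zero ℕ.+ total (v ∘ suc))
    ≡⟨ P.sym (P.cong₂ ℕ._+_ (foldr-allFin-suc ℕ._+_ 0 u) (foldr-allFin-suc ℕ._+_ 0 v)) ⟩
  total u ℕ.+ total v ∎
  where
  open P.≡-Reasoning
  open import Algebra.Properties.CommutativeSemigroup ℕ.+-commutativeSemigroup
    using () renaming (interchange to ℕ-interchange)

module FieldFacts {c ℓ : Level} (k : Field c ℓ) where
  open Field k hiding (zero)
  open import Relation.Binary.Reasoning.Setoid setoid
  open import Algebra.Properties.Ring ring using (-‿involutive)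
  open import Algebra.Properties.AbelianGroup +-abelianGroup using (ε⁻¹≈ε)

  cancel-nonzero : ∀ {u v} → ¬ (u ≈ 0#) → u * v ≈ 0# → v ≈ 0#
  cancel-nonzero {u} {v} u≉0 uv≈0 with inverse u u≉0
  ... | w , uw≈1 = begin
    v           ≈⟨ *-identityˡ v ⟨
    1# * v      ≈⟨ *-congʳ (trans (*-comm w u) uw≈1) ⟨
    (w * u) * v ≈⟨ *-assoc w u v ⟩
    w * (u * v) ≈⟨ *-congˡ uv≈0 ⟩
    w * 0#      ≈⟨ zeroʳ w ⟩
    0# ∎

  nonzero-* : ∀ {u v} → ¬ (u ≈ 0#) → ¬ (v ≈ 0#) → ¬ (u * v ≈ 0#)
  nonzero-* u≉0 v≉0 uv≈0 = v≉0 (cancel-nonzero u≉0 uv≈0)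

  nonzero-pow : ∀ {u} → ¬ (u ≈ 0#) → ∀ m → ¬ (pow k u m ≈ 0#)
  nonzero-pow u≉0 zero    = 1≉0
  nonzero-pow u≉0 (suc m) = nonzero-* u≉0 (nonzero-pow u≉0 m)

  -‿zero : ∀ {u} → - u ≈ 0# → u ≈ 0#
  -‿zero {u} -u≈0 = trans (sym (-‿involutive u)) (trans (-‿cong -u≈0) ε⁻¹≈ε)

  zero-* : ∀ {u} v → u ≈ 0# → u * v ≈ 0#
  zero-* v u≈0 = trans (*-congʳ u≈0) (zeroˡ v)

module FormAlgebra {c ℓ : Level} (k : Field c ℓ) where
  open Field k hiding (zero)
  open import Data.Product using (_×_)
  open import Relation.Binary.Reasoning.Setoid setoid
  open import Algebra.Properties.CommutativeSemigroup *-commutativeSemigroup using (interchange)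

  pow-+ : ∀ x m n → pow k x (m ℕ.+ n) ≈ pow k x m * pow k x n
  pow-+ x zero    n = sym (*-identityˡ _)
  pow-+ x (suc m) n = trans (*-congˡ (pow-+ x m n)) (sym (*-assoc _ _ _))

  monomial-⊹ : ∀ {n} (u v : Fin n → ℕ) x → monomial k (u ⊹ v) x ≈ monomial k u x * monomial k v x
  monomial-⊹ {zero}  u v x = sym (*-identityˡ 1#)
  monomial-⊹ {suc n} u v x = begin
    monomial k (u ⊹ v) x
      ≡⟨ foldr-allFin-suc _*_ 1# (λ i → pow k (x i) ((u ⊹ v) i)) ⟩
    pow k (x zero) (u zero ℕ.+ v zero) * monomial k ((u ⊹ v) ∘ suc) (x ∘ suc)
      ≈⟨ *-cong (pow-+ (x zero) (u zero) (v zero)) (monomial-⊹ (u ∘ suc) (v ∘ suc) (x ∘ suc)) ⟩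
    (pow k (x zero) (u zero) * pow k (x zero) (v zero)) * (monomial k (u ∘ suc) (x ∘ suc) * monomial k (v ∘ suc) (x ∘ suc))
      ≈⟨ interchange _ _ _ _ ⟩
    (pow k (x zero) (u zero) * monomial k (u ∘ suc) (x ∘ suc)) * (pow k (x zero) (v zero) * monomial k (v ∘ suc) (x ∘ suc))
      ≡⟨ P.sym (P.cong₂ _*_ (foldr-allFin-suc _*_ 1# (λ i → pow k (x i) (u i)))
                               (foldr-allFin-suc _*_ 1# (λ i → pow k (x i) (v i)))) ⟩
    monomial k u x * monomial k v x ∎

  monomial-𝟘 : ∀ n x → monomial k (𝟘 {n}) x ≈ 1#
  monomial-𝟘 zero    x = refl
  monomial-𝟘 (suc n) x = begin
    monomial k 𝟘 x              ≡⟨ foldr-allFin-suc _*_ 1# (λ i → pow k (x i) 0) ⟩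
    1# * monomial k 𝟘 (x ∘ suc) ≈⟨ *-identityˡ _ ⟩
    monomial k 𝟘 (x ∘ suc)      ≈⟨ monomial-𝟘 n (x ∘ suc) ⟩
    1# ∎

  monomial-unit : ∀ {n} (i : Fin n) x → monomial k (unit i) x ≈ x i
  monomial-unit {suc n} zero x = begin
    monomial k (unit zero) x               ≡⟨ foldr-allFin-suc _*_ 1# (λ j → pow k (x j) (unit zero j)) ⟩
    (x zero * 1#) * monomial k 𝟘 (x ∘ suc) ≈⟨ *-cong (*-identityʳ _) (monomial-𝟘 n (x ∘ suc)) ⟩
    x zero * 1#                            ≈⟨ *-identityʳ _ ⟩
    x zero ∎
  monomial-unit {suc n} (suc i) x = begin
    monomial k (unit (suc i)) x        ≡⟨ foldr-allFin-suc _*_ 1# (λ j → pow k (x j) (unit (suc i) j)) ⟩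
    1# * monomial k (unit i) (x ∘ suc) ≈⟨ *-identityˡ _ ⟩
    monomial k (unit i) (x ∘ suc)      ≈⟨ monomial-unit i (x ∘ suc) ⟩
    x (suc i) ∎

  Terms : ℕ → Set c
  Terms n = List (Carrier × (Fin n → ℕ))

  value : ∀ {n} → Terms n → (Fin n → Carrier) → Carrier
  value ts x = foldr (λ t s → (proj₁ t * monomial k (proj₂ t) x) + s) 0# ts

  Homogeneous : ∀ {n} → ℕ → Terms n → Set c
  Homogeneous e ts = All (λ t → total (proj₂ t) ≡ e) ts

  value-++ : ∀ {n} (ts us : Terms n) x → value (ts ++ us) x ≈ value ts x + value us x
  value-++ []       us x = sym (+-identityˡ _)
  value-++ (t ∷ ts) us x = trans (+-congˡ (value-++ ts us x)) (sym (+-assoc _ _ _))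

  homogeneous-++ : ∀ {n e} {ts us : Terms n} → Homogeneous e ts → Homogeneous e us → Homogeneous e (ts ++ us)
  homogeneous-++ []       q = q
  homogeneous-++ (p ∷ ps) q = p ∷ homogeneous-++ ps q

  _·_ : ∀ {n} → Carrier × (Fin n → ℕ) → Carrier × (Fin n → ℕ) → Carrier × (Fin n → ℕ)
  (a , u) · (b , v) = (a * b , u ⊹ v)

  times : ∀ {n} → Terms n → Terms n → Terms n
  times []       us = []
  times (t ∷ ts) us = map (t ·_) us ++ times ts us

  value-scale : ∀ {n} (t : Carrier × (Fin n → ℕ)) us x →
    value (map (t ·_) us) x ≈ (proj₁ t * monomial k (proj₂ t) x) * value us x
  value-scale t [] x = sym (zeroʳ _)
  value-scale (a , u) ((b , v) ∷ us) x = begin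
    (a * b) * monomial k (u ⊹ v) x + value (map ((a , u) ·_) us) x
      ≈⟨ +-cong (*-congˡ (monomial-⊹ u v x)) (value-scale (a , u) us x) ⟩
    (a * b) * (monomial k u x * monomial k v x) + (a * monomial k u x) * value us x
      ≈⟨ +-congʳ (interchange _ _ _ _) ⟩
    (a * monomial k u x) * (b * monomial k v x) + (a * monomial k u x) * value us x
      ≈⟨ distribˡ _ _ _ ⟨
    (a * monomial k u x) * (b * monomial k v x + value us x) ∎

  value-times : ∀ {n} (ts us : Terms n) x → value (times ts us) x ≈ value ts x * value us x
  value-times []       us x = sym (zeroˡ _)
  value-times (t ∷ ts) us x = begin
    value (map (t ·_) us ++ times ts us) x
      ≈⟨ value-++ (map (t ·_) us) (times ts us) x ⟩
    value (map (t ·_) us) x + value (times ts us) x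
      ≈⟨ +-cong (value-scale t us x) (value-times ts us x) ⟩
    (proj₁ t * monomial k (proj₂ t) x) * value us x + value ts x * value us x
      ≈⟨ distribʳ _ _ _ ⟨
    (proj₁ t * monomial k (proj₂ t) x + value ts x) * value us x ∎

  homogeneous-times : ∀ {n d e} {ts us : Terms n} →
    Homogeneous d ts → Homogeneous e us → Homogeneous (d ℕ.+ e) (times ts us)
  homogeneous-times {ts = []}    []       q = []
  homogeneous-times {ts = t ∷ _} (p ∷ ps) q = homogeneous-++ (scaled q) (homogeneous-times ps q)
    where
    scaled : ∀ {us} → Homogeneous _ us → Homogeneous _ (map (t ·_) us)
    scaled []       = []
    scaled {u ∷ _} (q ∷ qs) = P.trans (total-⊹ (proj₂ t) (proj₂ u)) (P.cong₂ ℕ._+_ p q) ∷ scaled qs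

  -- Polynomial expressions in n variables, indexed by their degree: every
  -- expression denotes a form, which 'expand' computes as a list of terms.
  infixl 6 _⊕_
  infixl 7 _⊗_
  data Expr (n : ℕ) : ℕ → Set c where
    var   : Fin n → Expr n 1
    const : Carrier → Expr n 0
    0ₑ    : ∀ {e} → Expr n e
    _⊕_   : ∀ {e} → Expr n e → Expr n e → Expr n e
    _⊗_   : ∀ {d e} → Expr n d → Expr n e → Expr n (d ℕ.+ e)
    cast  : ∀ {d e} → d ≡ e → Expr n d → Expr n e

  ⟦_⟧ : ∀ {n e} → Expr n e → (Fin n → Carrier) → Carrier
  ⟦ var i ⟧    x = x i
  ⟦ const a ⟧  x = a
  ⟦ 0ₑ ⟧       x = 0#
  ⟦ h ⊕ g ⟧    x = ⟦ h ⟧ x + ⟦ g ⟧ x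
  ⟦ h ⊗ g ⟧    x = ⟦ h ⟧ x * ⟦ g ⟧ x
  ⟦ cast _ h ⟧ x = ⟦ h ⟧ x

  expand : ∀ {n e} → Expr n e → Σ (Terms n) (Homogeneous e)
  expand (var i)      = ((1# , unit i) ∷ []) , (total-unit i ∷ [])
  expand {n} (const a) = ((a , 𝟘) ∷ []) , (total-𝟘 n ∷ [])
  expand 0ₑ           = [] , []
  expand (h ⊕ g)     with (ts , p) ← expand h | (us , q) ← expand g = ts ++ us , homogeneous-++ p q
  expand (h ⊗ g)     with (ts , p) ← expand h | (us , q) ← expand g = times ts us , homogeneous-times p q
  expand (cast eq h) with (ts , p) ← expand h = ts , P.subst (λ e → Homogeneous e ts) eq p

  expand-correct : ∀ {n e} (h : Expr n e) x → value (proj₁ (expand h)) x ≈ ⟦ h ⟧ x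
  expand-correct (var i)       x = trans (+-identityʳ _) (trans (*-identityˡ _) (monomial-unit i x))
  expand-correct {n} (const a) x = trans (+-identityʳ _) (trans (*-congˡ (monomial-𝟘 n x)) (*-identityʳ _))
  expand-correct 0ₑ           x = refl
  expand-correct (h ⊕ g)      x = trans (value-++ (proj₁ (expand h)) (proj₁ (expand g)) x)
                                        (+-cong (expand-correct h x) (expand-correct g x))
  expand-correct (h ⊗ g)      x = trans (value-times (proj₁ (expand h)) (proj₁ (expand g)) x)
                                        (*-cong (expand-correct h x) (expand-correct g x))
  expand-correct (cast eq h)  x = expand-correct h x

  toForm : ∀ {n e} → Expr n e → Form k e n
  toForm h = form (proj₁ (expand h)) (proj₂ (expand h))

  AnisotropicExpr : ∀ {n e} → Expr n e → Set (c ⊔ ℓ)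
  AnisotropicExpr {n} h = ∀ (x : Fin n → Carrier) i → ¬ (x i ≈ 0#) → ¬ (⟦ h ⟧ x ≈ 0#)

  anisotropicForm : ∀ {n e} (h : Expr n e) → AnisotropicExpr h → HasAnisotropicForm k e n
  anisotropicForm h anis = toForm h , λ (x , (i , xᵢ≉0) , h≈0) →
    anis x i xᵢ≉0 (trans (sym (expand-correct h x)) h≈0)

  powerₑ : ∀ {m d} → Expr m d → (a : ℕ) → Expr m (a ℕ.* d)
  powerₑ h zero    = const 1#
  powerₑ h (suc a) = h ⊗ powerₑ h a

  ⟦powerₑ⟧ : ∀ {m d} (h : Expr m d) a x → ⟦ powerₑ h a ⟧ x ≡ pow k (⟦ h ⟧ x) a
  ⟦powerₑ⟧ h zero    x = P.refl
  ⟦powerₑ⟧ h (suc a) x = P.cong (⟦ h ⟧ x *_) (⟦powerₑ⟧ h a x)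

  module Substitution {r m d : ℕ} (σ : Fin r → Expr m d) where
    product : (u : Fin r → ℕ) (l : List (Fin r)) → Expr m (foldr ℕ._+_ 0 (map u l) ℕ.* d)
    product u []      = const 1#
    product u (i ∷ l) = cast (P.sym (ℕ.*-distribʳ-+ d (u i) _)) (powerₑ (σ i) (u i) ⊗ product u l)

    ⟦product⟧ : ∀ u l x → ⟦ product u l ⟧ x ≡ foldr _*_ 1# (map (λ i → pow k (⟦ σ i ⟧ x) (u i)) l)
    ⟦product⟧ u []      x = P.refl
    ⟦product⟧ u (i ∷ l) x = P.cong₂ _*_ (⟦powerₑ⟧ (σ i) (u i) x) (⟦product⟧ u l x)

    sum : ∀ {e} (ts : Terms r) → Homogeneous e ts → Expr m (e ℕ.* d)
    sum []             []       = 0ₑ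
    sum ((a , u) ∷ ts) (p ∷ ps) = cast (P.cong (ℕ._* d) p) (const a ⊗ product u (allFin r)) ⊕ sum ts ps

    ⟦sum⟧ : ∀ {e} (ts : Terms r) (ps : Homogeneous e ts) x → ⟦ sum ts ps ⟧ x ≡ value ts (λ i → ⟦ σ i ⟧ x)
    ⟦sum⟧ []             []       x = P.refl
    ⟦sum⟧ ((a , u) ∷ ts) (p ∷ ps) x =
      P.cong₂ _+_ (P.cong (a *_) (⟦product⟧ u (allFin r) x)) (⟦sum⟧ ts ps x)

  substitute : ∀ {r m d e} → Form k e r → (Fin r → Expr m d) → Expr m (e ℕ.* d)
  substitute f σ = Substitution.sum σ (Form.terms f) (Form.homogeneous f)

  ⟦substitute⟧ : ∀ {r m d e} (f : Form k e r) (σ : Fin r → Expr m d) x →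
    ⟦ substitute f σ ⟧ x ≡ eval k f (λ i → ⟦ σ i ⟧ x)
  ⟦substitute⟧ f σ x = Substitution.⟦sum⟧ σ (Form.terms f) (Form.homogeneous f) x

module Constructions {c ℓ : Level} (k : Field c ℓ) where
  open Field k hiding (zero)
  open FormAlgebra k
  open FieldFacts k

  asExpr : ∀ {r e} → Form k e r → Expr r e
  asExpr {e = e} f = cast (ℕ.*-identityʳ e) (substitute f var)

  power-anisotropic : ∀ {d r} m → HasAnisotropicForm k d r → HasAnisotropicForm k (m ℕ.* d) r
  power-anisotropic m (f , anis) = anisotropicForm (powerₑ (asExpr f) m) λ x i xᵢ≉0 fᵐ≈0 →
    let ⟦fᵐ⟧ = P.trans (⟦powerₑ⟧ (asExpr f) m x) (P.cong (λ v → pow k v m) (⟦substitute⟧ f var x))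
    in nonzero-pow (λ f≈0 → anis (x , (i , xᵢ≉0) , f≈0)) m (trans (reflexive (P.sym ⟦fᵐ⟧)) fᵐ≈0)

  module Composite {d r} (f : Form k d r) (anis : Anisotropic k f) where
    composite : ∀ n {m} → (Fin (r ℕ.^ n) → Fin m) → Expr m (d ℕ.^ n)
    composite zero    ξ = var (ξ zero)
    composite (suc n) ξ = substitute f (λ i → composite n (ξ ∘ combine i))

    composite-anisotropic : ∀ n {m} (ξ : Fin (r ℕ.^ n) → Fin m) x j →
      ¬ (x (ξ j) ≈ 0#) → ¬ (⟦ composite n ξ ⟧ x ≈ 0#)
    composite-anisotropic zero    ξ x zero x≉0 = x≉0
    composite-anisotropic (suc n) ξ x j  x≉0 f≈0 with combine-surjective {r} j
    ... | i , l , P.refl = anis (y , (i , yᵢ≉0) , trans (reflexive (P.sym (⟦substitute⟧ f σ x))) f≈0)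
      where
      σ : Fin r → Expr _ (d ℕ.^ n)
      σ i′ = composite n (ξ ∘ combine i′)
      y : Fin r → Carrier
      y i′ = ⟦ σ i′ ⟧ x
      yᵢ≉0 : ¬ (y i ≈ 0#)
      yᵢ≉0 = composite-anisotropic n (ξ ∘ combine i) x l x≉0

  composite-anisotropicForm : ∀ {d r} n → HasAnisotropicForm k d r → HasAnisotropicForm k (d ℕ.^ n) (r ℕ.^ n)
  composite-anisotropicForm n (f , anis) =
    anisotropicForm (composite n id) (λ x → composite-anisotropic n id x)
    where open Composite f anis

-- The polynomials of the ternary construction, written once over any carrier with
-- +, ·, − and the constants 2, 3, so that they can be read both in a field and as
-- ring-solver syntax.
module CubicPolynomials {a} {R : Set a} (plus times : R → R → R) (negate : R → R) (two three : R) where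
  infixl 6 _+_ _-_
  infixl 7 _*_
  infix  8 -_

  _+_ _*_ : R → R → R
  _+_ = plus
  _*_ = times

  -_ : R → R
  -_ = negate

  _-_ : R → R → R
  x - y = x + - y

  cubic : R → R → R → R → R → R → R
  cubic a b c d X Y = a * (X * X * X) + b * (X * X * Y) + c * (X * Y * Y) + d * (Y * Y * Y)

  quadric : R → R → R → R → R → R
  quadric x y z X Y = z * (X * X) + y * (X * Y) + x * (Y * Y)

  E : R → R → R → R → R
  E a b y z = b * z - a * y

  A : R → R → R → R → R → R → R
  A a b c x y z = c * z * z - a * z * x - E a b y z * y

  B : R → R → R → R → R → R → R
  B a b d x y z = d * z * z - E a b y z * x

  norm : R → R → R → R → R → R → R → R
  norm a b c d x y z =
      (a * a) * (x * x * x) + (- (a * b)) * (x * x * y) + (- (two * (a * c))) * (x * x * z)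
    + (a * c) * (x * y * y) + (three * (a * d)) * (x * y * z) + (- (a * d)) * (y * y * y)
    + (b * b) * (x * x * z) + (- (b * c)) * (x * y * z) + (- (two * (b * d))) * (x * z * z)
    + (b * d) * (y * y * z) + (c * c) * (x * z * z) + (- (c * d)) * (y * z * z) + (d * d) * (z * z * z)

  normByZ : R → R → R → R → R → R → R → R
  normByZ a b c d x y z =
      (- (two * (a * c))) * (x * x) + (three * (a * d)) * (x * y) + (b * b) * (x * x)
    + (- (b * c)) * (x * y) + (- (two * (b * d))) * (x * z) + (b * d) * (y * y)
    + (c * c) * (x * z) + (- (c * d)) * (y * z) + (d * d) * (z * z)

module TernaryCubic {ℓ₁ ℓ₂ : Level} (k : Field ℓ₁ ℓ₂) where
  open Field k hiding (zero)
  open IntegerCoefficients commutativeRing using (solve; _:=_; _:+_; _:*_; :-_; con; Polynomial; ⟦_⟧ℤ)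
  open FieldFacts k
  open FormAlgebra k
  open import Relation.Binary.Reasoning.Setoid setoid

  open CubicPolynomials _+_ _*_ -_ ⟦ ℤ.+ 2 ⟧ℤ ⟦ ℤ.+ 3 ⟧ℤ using (cubic; quadric; E; A; B; norm; normByZ)
  module Syntax {m : ℕ} = CubicPolynomials (_:+_ {m}) _:*_ :-_ (con (ℤ.+ 2)) (con (ℤ.+ 3))

  0ₚ 1ₚ : ∀ {m} → Polynomial m
  0ₚ = con (ℤ.+ 0)
  1ₚ = con (ℤ.+ 1)

  norm-as-quadric : ∀ a b c d x y z →
    z * z * norm a b c d x y z ≈ quadric x y z (- B a b d x y z) (A a b c x y z)
  norm-as-quadric = solve 7 (λ a b c d x y z →
    z :* z :* Syntax.norm a b c d x y z := Syntax.quadric x y z (:- Syntax.B a b d x y z) (Syntax.A a b c x y z)) refl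

  -- N(x,y,z) = −a·G(−x,y) + z·(…): on z = 0, N is essentially the binary cubic.
  norm-at-z : ∀ a b c d x y z → norm a b c d x y z ≈ - (a * cubic a b c d (- x) y) + z * normByZ a b c d x y z
  norm-at-z = solve 7 (λ a b c d x y z →
    Syntax.norm a b c d x y z := :- (a :* Syntax.cubic a b c d (:- x) y) :+ z :* Syntax.normByZ a b c d x y z) refl

  -- Two instances of z²G(X,Y) = (azX + eY)·H(X,Y) + (AX + BY)·Y², the identity that
  -- relates the binary cubic to the quadric.
  cubic-at-[-B,A] : ∀ a b c d x y z →
    z * z * cubic a b c d (- B a b d x y z) (A a b c x y z)
      ≈ (a * z * (- B a b d x y z) + E a b y z * A a b c x y z) * quadric x y z (- B a b d x y z) (A a b c x y z)
  cubic-at-[-B,A] = solve 7 (λ a b c d x y z →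
    z :* z :* Syntax.cubic a b c d (:- Syntax.B a b d x y z) (Syntax.A a b c x y z)
      := (a :* z :* (:- Syntax.B a b d x y z) :+ Syntax.E a b y z :* Syntax.A a b c x y z)
         :* Syntax.quadric x y z (:- Syntax.B a b d x y z) (Syntax.A a b c x y z)) refl

  cubic-at-[-e,az] : ∀ a b c d x y z →
    z * z * cubic a b c d (- E a b y z) (a * z)
      ≈ (A a b c x y z * (- E a b y z) + B a b d x y z * (a * z)) * (a * z) * (a * z)
  cubic-at-[-e,az] = solve 7 (λ a b c d x y z →
    z :* z :* Syntax.cubic a b c d (:- Syntax.E a b y z) (a :* z)
      := (Syntax.A a b c x y z :* (:- Syntax.E a b y z) :+ Syntax.B a b d x y z :* (a :* z)) :* (a :* z) :* (a :* z)) refl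

  quadric-at-[X,A] : ∀ x y z X A → quadric x y z X A ≈ z * (X * X) + A * (x * A + y * X)
  quadric-at-[X,A] = solve 5 (λ x y z X A →
    Syntax.quadric x y z X A := z :* (X :* X) :+ A :* (x :* A :+ y :* X)) refl

  cubic-at-[1,0] : ∀ a b c d → cubic a b c d 1# 0# ≈ a
  cubic-at-[1,0] = solve 4 (λ a b c d → Syntax.cubic a b c d 1ₚ 0ₚ := a) refl

  CubicAnisotropic : Carrier → Carrier → Carrier → Carrier → Set (ℓ₁ Level.⊔ ℓ₂)
  CubicAnisotropic a b c d = ∀ X Y → ¬ (X ≈ 0#) ⊎ ¬ (Y ≈ 0#) → ¬ (cubic a b c d X Y ≈ 0#)

  module _ {a b c d : Carrier} (G-anisotropic : CubicAnisotropic a b c d) where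
    leading-nonzero : ¬ (a ≈ 0#)
    leading-nonzero a≈0 = G-anisotropic 1# 0# (inj₁ 1≉0) (trans (cubic-at-[1,0] a b c d) a≈0)

    -- On the plane z = 0, N vanishes only where G(−x, y) does.
    norm-anisotropic-z≈0 : ∀ {x y z} → z ≈ 0# → ¬ (x ≈ 0#) ⊎ ¬ (y ≈ 0#) → ¬ (norm a b c d x y z ≈ 0#)
    norm-anisotropic-z≈0 {x} {y} {z} z≈0 nontrivial N≈0 =
      G-anisotropic (- x) y (map₁ (λ x≉0 -x≈0 → x≉0 (-‿zero -x≈0)) nontrivial)
        (cancel-nonzero leading-nonzero (-‿zero -aG≈0))
      where
      -aG≈0 : - (a * cubic a b c d (- x) y) ≈ 0#
      -aG≈0 = begin
        - (a * cubic a b c d (- x) y)                              ≈⟨ +-identityʳ _ ⟨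
        - (a * cubic a b c d (- x) y) + 0#                         ≈⟨ +-congˡ (zero-* _ z≈0) ⟨
        - (a * cubic a b c d (- x) y) + z * normByZ a b c d x y z  ≈⟨ norm-at-z a b c d x y z ⟨
        norm a b c d x y z                                         ≈⟨ N≈0 ⟩
        0# ∎

    -- Off that plane, N = 0 forces H(−B, A) = 0, then G(−B, A) = 0, hence A = 0,
    -- then B = 0, and finally G(−e, az) = 0 with az ≠ 0: a contradiction.
    norm-anisotropic-z≉0 : ∀ {x y z} → ¬ (z ≈ 0#) → ¬ (norm a b c d x y z ≈ 0#)
    norm-anisotropic-z≉0 {x} {y} {z} z≉0 N≈0 = ¬A≉0 (λ A≈0 → ¬B≉0 A≈0 (λ B≈0 → last-step A≈0 B≈0))
      where
      A′ = A a b c x y z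
      B′ = B a b d x y z
      e  = E a b y z

      z²≉0 : ¬ (z * z ≈ 0#)
      z²≉0 = nonzero-* z≉0 z≉0

      H≈0 : quadric x y z (- B′) A′ ≈ 0#
      H≈0 = trans (sym (norm-as-quadric a b c d x y z)) (trans (*-congˡ N≈0) (zeroʳ _))

      ¬A≉0 : ¬ ¬ (A′ ≈ 0#)
      ¬A≉0 A≉0 = G-anisotropic (- B′) A′ (inj₂ A≉0) (cancel-nonzero z²≉0
        (trans (cubic-at-[-B,A] a b c d x y z) (trans (*-congˡ H≈0) (zeroʳ _))))

      ¬B≉0 : A′ ≈ 0# → ¬ ¬ (B′ ≈ 0#)
      ¬B≉0 A≈0 B≉0 = nonzero-* z≉0 (nonzero-* -B≉0 -B≉0) (begin
        z * (- B′ * - B′)                            ≈⟨ +-identityʳ _ ⟨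
        z * (- B′ * - B′) + 0#                       ≈⟨ +-congˡ (zero-* _ A≈0) ⟨
        z * (- B′ * - B′) + A′ * (x * A′ + y * - B′) ≈⟨ quadric-at-[X,A] x y z (- B′) A′ ⟨
        quadric x y z (- B′) A′                      ≈⟨ H≈0 ⟩
        0# ∎)
        where
        -B≉0 : ¬ (- B′ ≈ 0#)
        -B≉0 -B≈0 = B≉0 (-‿zero -B≈0)

      last-step : A′ ≈ 0# → B′ ≈ 0# → ⊥
      last-step A≈0 B≈0 = G-anisotropic (- e) (a * z) (inj₂ (nonzero-* leading-nonzero z≉0))
        (cancel-nonzero z²≉0 (trans (cubic-at-[-e,az] a b c d x y z) (zero-* _ (zero-* _ linear≈0))))
        where
        linear≈0 : A′ * (- e) + B′ * (a * z) ≈ 0#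
        linear≈0 = trans (+-cong (zero-* _ A≈0) (zero-* _ B≈0)) (+-identityʳ 0#)

    -- Either z ≠ 0, or (as the goal is ⊥) we may assume z = 0.
    norm-anisotropic : ∀ {x y z} → (¬ (x ≈ 0#) ⊎ ¬ (y ≈ 0#)) ⊎ ¬ (z ≈ 0#) → ¬ (norm a b c d x y z ≈ 0#)
    norm-anisotropic (inj₂ z≉0)  = norm-anisotropic-z≉0 z≉0
    norm-anisotropic (inj₁ xy≉0) N≈0 =
      (λ z≉0 → norm-anisotropic-z≉0 z≉0 N≈0) (λ z≈0 → norm-anisotropic-z≈0 z≈0 xy≉0 N≈0)

  point₂ : Carrier → Carrier → Fin 2 → Carrier
  point₂ X Y zero       = X
  point₂ X Y (suc zero) = Y

  -- The coefficients of a binary cubic form, read off from its terms a·X^i·Y^j: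
  -- coefficient j collects the terms with i = j.
  select : ℕ → ℕ → Carrier → Carrier
  select j i a = if i ℕ.≡ᵇ j then a else 0#

  coefficient : ℕ → Terms 2 → Carrier
  coefficient j []             = 0#
  coefficient j ((a , u) ∷ ts) = select j (u zero) a + coefficient j ts

  binaryCubic : Terms 2 → Carrier → Carrier → Carrier
  binaryCubic ts = cubic (coefficient 3 ts) (coefficient 2 ts) (coefficient 1 ts) (coefficient 0 ts)

  term-as-cubic : ∀ a i j X Y → i ℕ.+ (j ℕ.+ 0) ≡ 3 →
    a * (pow k X i * (pow k Y j * 1#)) ≈ cubic (select 3 i a) (select 2 i a) (select 1 i a) (select 0 i a) X Y
  term-as-cubic a 3 0 X Y P.refl = solve 3 (λ a X Y →
    a :* (X :* (X :* (X :* 1ₚ)) :* (1ₚ :* 1ₚ))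
      := Syntax.cubic a 0ₚ 0ₚ 0ₚ X Y) refl a X Y
  term-as-cubic a 2 1 X Y P.refl = solve 3 (λ a X Y →
    a :* (X :* (X :* 1ₚ) :* (Y :* 1ₚ :* 1ₚ))
      := Syntax.cubic 0ₚ a 0ₚ 0ₚ X Y) refl a X Y
  term-as-cubic a 1 2 X Y P.refl = solve 3 (λ a X Y →
    a :* (X :* 1ₚ :* (Y :* (Y :* 1ₚ) :* 1ₚ))
      := Syntax.cubic 0ₚ 0ₚ a 0ₚ X Y) refl a X Y
  term-as-cubic a 0 3 X Y P.refl = solve 3 (λ a X Y →
    a :* (1ₚ :* (Y :* (Y :* (Y :* 1ₚ)) :* 1ₚ))
      := Syntax.cubic 0ₚ 0ₚ 0ₚ a X Y) refl a X Y

  cubic-zero : ∀ X Y → 0# ≈ cubic 0# 0# 0# 0# X Y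
  cubic-zero = solve 2 (λ X Y → 0ₚ := Syntax.cubic 0ₚ 0ₚ 0ₚ 0ₚ X Y) refl

  cubic-+ : ∀ a b c d a′ b′ c′ d′ X Y →
    cubic a b c d X Y + cubic a′ b′ c′ d′ X Y ≈ cubic (a + a′) (b + b′) (c + c′) (d + d′) X Y
  cubic-+ = solve 10 (λ a b c d a′ b′ c′ d′ X Y →
    Syntax.cubic a b c d X Y :+ Syntax.cubic a′ b′ c′ d′ X Y := Syntax.cubic (a :+ a′) (b :+ b′) (c :+ c′) (d :+ d′) X Y) refl

  value-as-cubic : ∀ ts → Homogeneous 3 ts → ∀ X Y → value ts (point₂ X Y) ≈ binaryCubic ts X Y
  value-as-cubic []             []       X Y = cubic-zero X Y
  value-as-cubic ((a , u) ∷ ts) (p ∷ ps) X Y =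
    trans (+-cong (term-as-cubic a (u zero) (u (suc zero)) X Y p) (value-as-cubic ts ps X Y)) (cubic-+ _ _ _ _ _ _ _ _ X Y)

  normExpr : Carrier → Carrier → Carrier → Carrier → Expr 3 3
  normExpr a b c d =
      const (a * a) ⊗ (x ⊗ x ⊗ x) ⊕ const (- (a * b)) ⊗ (x ⊗ x ⊗ y) ⊕ const (- (two * (a * c))) ⊗ (x ⊗ x ⊗ z)
    ⊕ const (a * c) ⊗ (x ⊗ y ⊗ y) ⊕ const (three * (a * d)) ⊗ (x ⊗ y ⊗ z) ⊕ const (- (a * d)) ⊗ (y ⊗ y ⊗ y)
    ⊕ const (b * b) ⊗ (x ⊗ x ⊗ z) ⊕ const (- (b * c)) ⊗ (x ⊗ y ⊗ z) ⊕ const (- (two * (b * d))) ⊗ (x ⊗ z ⊗ z)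
    ⊕ const (b * d) ⊗ (y ⊗ y ⊗ z) ⊕ const (c * c) ⊗ (x ⊗ z ⊗ z) ⊕ const (- (c * d)) ⊗ (y ⊗ z ⊗ z)
    ⊕ const (d * d) ⊗ (z ⊗ z ⊗ z)
    where
    x y z : Expr 3 1
    x = var zero
    y = var (suc zero)
    z = var (suc (suc zero))
    two three : Carrier
    two   = ⟦ ℤ.+ 2 ⟧ℤ
    three = ⟦ ℤ.+ 3 ⟧ℤ

  ternary-from-binary : HasAnisotropicForm k 3 2 → HasAnisotropicForm k 3 3
  ternary-from-binary (form ts homogeneous , anis) =
    anisotropicForm (normExpr a b c d) λ v i vᵢ≉0 →
      norm-anisotropic G-anisotropic (nonzero-coordinate v i vᵢ≉0)
    where
    a = coefficient 3 ts
    b = coefficient 2 ts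
    c = coefficient 1 ts
    d = coefficient 0 ts

    G-anisotropic : CubicAnisotropic a b c d
    G-anisotropic X Y nontrivial G≈0 =
      anis (point₂ X Y , witness nontrivial , trans (value-as-cubic ts homogeneous X Y) G≈0)
      where
      witness : ¬ (X ≈ 0#) ⊎ ¬ (Y ≈ 0#) → Σ (Fin 2) λ i → ¬ (point₂ X Y i ≈ 0#)
      witness (inj₁ X≉0) = zero , X≉0
      witness (inj₂ Y≉0) = suc zero , Y≉0

    nonzero-coordinate : ∀ (v : Fin 3 → Carrier) i → ¬ (v i ≈ 0#) →
      (¬ (v zero ≈ 0#) ⊎ ¬ (v (suc zero) ≈ 0#)) ⊎ ¬ (v (suc (suc zero)) ≈ 0#)
    nonzero-coordinate v zero             v≉0 = inj₁ (inj₁ v≉0)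
    nonzero-coordinate v (suc zero)       v≉0 = inj₁ (inj₂ v≉0)
    nonzero-coordinate v (suc (suc zero)) v≉0 = inj₂ v≉0

fin-≤∞ : ∀ {m n} → fin m ≤∞ fin n → m ℕ.≤ n
fin-≤∞ (fin≤fin m≤n) = m≤n

-- r ≤ r^(n+1), so the dimension never drops along r ↦ rⁿ for n ≥ 1.
≤-^-suc : ∀ r n → r ℕ.≤ r ℕ.^ suc n
≤-^-suc zero    n = ℕ.z≤n
≤-^-suc (suc r) n = ℕ.m≤m*n (suc r) (suc r ℕ.^ n) {{ℕ.m^n≢0 (suc r) n}}

module UInvariant {c ℓ : Level} (k : Field c ℓ) where

  emptyForm : ∀ e → HasAnisotropicForm k e 0
  emptyForm e = form [] [] , λ { (_ , (() , _) , _) }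

  -- A finite value m of u(e,k) is attained: it is impossible that no anisotropic
  -- form of dimension m exists, as m − 1 would then be a smaller upper bound.
  u-attained : ∀ {e m} → IsU k e (fin m) → ¬ ¬ HasAnisotropicForm k e m
  u-attained {e} {zero}  _                 no-form = no-form (emptyForm e)
  u-attained {e} {suc m} (bounded , least) no-form = ℕ.1+n≰n (fin-≤∞ (least (fin m) bounded-by-m))
    where
    bounded-by-m : ∀ r → HasAnisotropicForm k e r → fin r ≤∞ fin m
    bounded-by-m r form-r = fin≤fin (ℕ.m<1+n⇒m≤n
      (ℕ.≤∧≢⇒< (fin-≤∞ (bounded r form-r)) λ { P.refl → no-form form-r }))

  u-monotone : ∀ {d e x y} → (∀ r → HasAnisotropicForm k d r → HasAnisotropicForm k e r) →
    IsU k d x → IsU k e y → x ≤∞ y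
  u-monotone construct (_ , least-d) (bounded-e , _) = least-d _ λ r form-r → bounded-e r (construct r form-r)

  u-power : ∀ {d e x y} n → 0 ℕ.< n →
    (∀ r → HasAnisotropicForm k d r → HasAnisotropicForm k e (r ℕ.^ n)) →
    IsU k d x → IsU k e y → (x ^∞ n) ≤∞ y
  u-power {x = x} {∞} n _ _ _ _ = (x ^∞ n) ≤∞∞
  u-power {x = ∞} {fin N} zero () _ _ _
  u-power {d} {x = ∞} {fin N} (suc n) _ construct (_ , least-d) (bounded-e , _) =
    ⊥-elim (∞≰fin (least-d (fin N) bounded-by-N))
    where
    ∞≰fin : ¬ (∞ ≤∞ fin N)
    ∞≰fin ()
    bounded-by-N : ∀ r → HasAnisotropicForm k d r → fin r ≤∞ fin N
    bounded-by-N r form-r = fin≤fin (ℕ.≤-trans (≤-^-suc r n) (fin-≤∞ (bounded-e _ (construct r form-r))))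
  u-power {x = fin m} {fin N} n _ construct u-d (bounded-e , _) with m ℕ.^ n ℕ.≤? N
  ... | yes mⁿ≤N = fin≤fin mⁿ≤N
  ... | no  mⁿ≰N = ⊥-elim (u-attained u-d λ form-m → mⁿ≰N (fin-≤∞ (bounded-e _ (construct m form-m))))

open Constructions using (power-anisotropic; composite-anisotropicForm)
open TernaryCubic using (ternary-from-binary)
open UInvariant using (u-attained; u-monotone; u-power)

open import Data.Nat using (_*_; _^_; _<_)
open import Data.Product using (_×_)

lemma3 : ∀ {c ℓ} (k : Field c ℓ) →
    ((CharZeroOrAbove k 3 → ∀ x → IsU k 3 x → ¬ (x ≡ fin 2))
    × (∀ d n → 0 < d → 0 < n → CharZeroOrAbove k (d ^ n) →
         ∀ x y → IsU k d x → IsU k (d ^ n) y → (x ^∞ n) ≤∞ y))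
    × (∀ d₁ m → 0 < d₁ → 1 < m → CharZeroOrAbove k (m * d₁) →
         ∀ u y → IsU k d₁ u → IsU k (m * d₁) y → u ≤∞ y)
lemma3 k = (part-i , part-ii) , part-iii
  where
  -- u(3,k) = 2 would give an anisotropic binary cubic, hence a ternary one.
  part-i : CharZeroOrAbove k 3 → ∀ x → IsU k 3 x → ¬ (x ≡ fin 2)
  part-i _ x u@(bounded , _) P.refl = u-attained k u λ binary →
    ℕ.n≮n 2 (fin-≤∞ (bounded 3 (ternary-from-binary k binary)))

  part-ii : ∀ d n → 0 < d → 0 < n → CharZeroOrAbove k (d ^ n) →
    ∀ x y → IsU k d x → IsU k (d ^ n) y → (x ^∞ n) ≤∞ y
  part-ii d n _ 0<n _ _ _ = u-power k n 0<n (λ _ → composite-anisotropicForm k n)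

  part-iii : ∀ d₁ m → 0 < d₁ → 1 < m → CharZeroOrAbove k (m * d₁) →
    ∀ u y → IsU k d₁ u → IsU k (m * d₁) y → u ≤∞ y
  part-iii d₁ m _ _ _ _ _ = u-monotone k (λ _ → power-anisotropic k m)
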